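{- Let $n\geq 3$ and let $M_n=(a_{ij})_{1\leq i,j\leq n-1}$ be the $(n-1)\times(n-1)$ integer matrix with entries $a_{ij}=0$ if $i+j=n$, $a_{ij}=2$ if $i+j=n-1$, and $a_{ij}=1$ otherwise. Then the Smith normal form of $M_n$ over $\mathbb{Z}$ has diagonal entries $(1,1,\dots,1,\binom n2-1)$, where $1$ occurs $n-2$ times.
   Context: The Smith normal form over $\mathbb{Z}$ of a nonsingular square integer matrix $M$ is the unique diagonal matrix $\mathrm{diag}(d_1,\dots,d_m)$ with positive integers $d_1\mid d_2\mid\cdots\mid d_m$ such that $M=P\,\mathrm{diag}(d_1,\dots,d_m)\,Q$ for some $P,Q\in \mathrm{GL}_m(\mathbb{Z})$. -}

module Defs where

open import Data.Nat as ℕ using (ℕ; zero; suc; _≡ᵇ_; _∸_)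
open import Data.Nat.Combinatorics using (_C_)
open import Data.Nat.Divisibility using (_∣_)
open import Data.Integer as ℤ using (ℤ; +_)
open import Data.Fin as Fin using (Fin; toℕ)
open import Data.Bool using (if_then_else_)
open import Data.Product using (Σ; _×_; ∃₂)
open import Relation.Binary.PropositionalEquality using (_≡_)
open import Relation.Nullary using (does)

Matrix : ℕ → ℕ → Set
Matrix m n = Fin m → Fin n → ℤ

sumFin : ∀ {n} → (Fin n → ℤ) → ℤ
sumFin {zero}  f = + 0
sumFin {suc n} f = f Fin.zero ℤ.+ sumFin (λ i → f (Fin.suc i))

_⊗_ : ∀ {m k n} → Matrix m k → Matrix k n → Matrix m n
(A ⊗ B) i j = sumFin (λ l → A i l ℤ.* B l j)

_≋_ : ∀ {m n} → Matrix m n → Matrix m n → Set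
A ≋ B = ∀ i j → A i j ≡ B i j

idMat : ∀ {m} → Matrix m m
idMat i j = if does (i Fin.≟ j) then + 1 else + 0

diagMat : ∀ {m} → (Fin m → ℕ) → Matrix m m
diagMat d i j = if does (i Fin.≟ j) then + d i else + 0

IsUnimodular : ∀ {m} → Matrix m m → Set
IsUnimodular {m} P = Σ (Matrix m m) λ P' → ((P ⊗ P') ≋ idMat) × ((P' ⊗ P) ≋ idMat)

IsSmithNormalForm : ∀ {m} → Matrix m m → (Fin m → ℕ) → Set
IsSmithNormalForm {m} M d =
  (∀ i → 0 ℕ.< d i)
  × (∀ (i j : Fin m) → i Fin.≤ j → d i ∣ d j)
  × ∃₂ λ (P Q : Matrix m m) → IsUnimodular P × IsUnimodular Q × (M ≋ ((P ⊗ diagMat d) ⊗ Q))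

-- The (n-1)×(n-1) matrix M_n. With 1-based indices i' = toℕ i + 1, j' = toℕ j + 1:
-- entry 0 if i'+j' = n, 2 if i'+j' = n-1, 1 otherwise.
M : (n : ℕ) → Matrix (n ∸ 1) (n ∸ 1)
M n i j =
  if (toℕ i ℕ.+ toℕ j ℕ.+ 2) ≡ᵇ n then + 0
  else if (toℕ i ℕ.+ toℕ j ℕ.+ 2) ≡ᵇ (n ∸ 1) then + 2
  else + 1

targetDiag : (n : ℕ) → Fin (n ∸ 1) → ℕ
targetDiag n i = if toℕ i ≡ᵇ (n ∸ 2) then (n C 2) ∸ 1 else 1

-- Index rows and columns from 0 and put m = n - 1, L = n - 2. The entry (i, j) of M n depends
-- only on s = i + j and equals 1 - [s = L] + [s + 1 = L], a difference of consecutive rows of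
-- X i j = (m - i) - [i + j = L]; so M n = A X with A the unimodular matrix "row minus next row".
-- The partial row sums Y of X, Y i j = S i - [L ≤ i + j] with S i = m + (m - 1) + ⋯ + (m - i),
-- satisfy X = Aᵀ Y. Each row i < L of Y is the constant S i - 1 plus a 0/1 staircase row, and
-- the last row is the constant S L - 1 = C(n,2) - 1. Hence Y = diag(1, …, 1, C(n,2) - 1) Q where
-- Q, whose last row is all ones, comes from the unimodular staircase [i + j ≤ L] by a cyclic
-- permutation of the rows followed by adding multiples of the last row to the others.

module Submission where

open import Function.Base using (_∘_)
open import Data.Bool.Base using (Bool; if_then_else_)
open import Data.Nat.Base as ℕ using (ℕ; zero; suc; _∸_; _≡ᵇ_; _≤ᵇ_; _<ᵇ_; _<_; _≤_; z≤n; s≤s)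
import Data.Nat.Properties as ℕ
open import Data.Nat.Divisibility using (_∣_; 1∣_; ∣-refl)
open import Data.Nat.Combinatorics using (_C_; nC1≡n; nCk+nC[k+1]≡[n+1]C[k+1])
open import Data.Integer.Base as ℤ using (ℤ; +_; _+_; _*_; -_; _-_)
import Data.Integer.Properties as ℤ
open import Data.Integer.Tactic.RingSolver using (solve-∀)
open import Data.Fin as Fin using (Fin; toℕ)
open import Data.Fin.Properties using (toℕ<n; toℕ-injective)
open import Data.Sum.Base using (inj₁; inj₂)
open import Data.Product.Base using (_×_; _,_; proj₁; proj₂; ∃₂)
open import Relation.Binary.Bundles using (Setoid)
open import Relation.Binary.Definitions using (tri<; tri≈; tri>)
open import Relation.Binary.PropositionalEquality
open import Relation.Nullary using (Dec; does; yes; no; ¬_; contradiction)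
import Relation.Binary.Reasoning.Setoid
open import Relation.Nullary.Decidable using (dec-true; dec-false)
open import Algebra.Properties.Semiring.Sum ℤ.+-*-semiring
  using (sum; sum-cong-≗; ∑-comm; *-distribˡ-sum; *-distribʳ-sum)
open import Defs

⟦_⟧ : Bool → ℤ
⟦ b ⟧ = if b then + 1 else + 0

⟦⟧-yes : ∀ {p} {P : Set p} (p? : Dec P) → P → ⟦ does p? ⟧ ≡ + 1
⟦⟧-yes p? p = cong ⟦_⟧ (dec-true p? p)

⟦⟧-no : ∀ {p} {P : Set p} (p? : Dec P) → ¬ P → ⟦ does p? ⟧ ≡ + 0
⟦⟧-no p? ¬p = cong ⟦_⟧ (dec-false p? ¬p)

δ : ℕ → ℕ → ℤ
δ a b = ⟦ a ≡ᵇ b ⟧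

δ-sym : ∀ a b → δ a b ≡ δ b a
δ-sym a b with a ℕ.≟ b
... | yes refl = refl
... | no a≢b = trans (⟦⟧-no (a ℕ.≟ b) a≢b) (sym (⟦⟧-no (b ℕ.≟ a) (a≢b ∘ sym)))

⟦≤ᵇ-suc⟧ : ∀ a s → ⟦ a ≤ᵇ suc s ⟧ ≡ ⟦ a ≤ᵇ s ⟧ + δ a (suc s)
⟦≤ᵇ-suc⟧ a s with ℕ.<-cmp a (suc s)
... | tri< a<1+s _ _
  rewrite ⟦⟧-yes (a ℕ.≤? suc s) (ℕ.<⇒≤ a<1+s) | ⟦⟧-yes (a ℕ.≤? s) (ℕ.≤-pred a<1+s)
        | ⟦⟧-no (a ℕ.≟ suc s) (ℕ.<⇒≢ a<1+s) = refl
... | tri≈ _ refl _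
  rewrite ⟦⟧-yes (suc s ℕ.≤? suc s) ℕ.≤-refl | ⟦⟧-no (suc s ℕ.≤? s) ℕ.1+n≰n
        | ⟦⟧-yes (suc s ℕ.≟ suc s) refl = refl
... | tri> _ _ a>1+s
  rewrite ⟦⟧-no (a ℕ.≤? suc s) (ℕ.<⇒≱ a>1+s) | ⟦⟧-no (a ℕ.≤? s) (ℕ.<⇒≱ (ℕ.<-trans (ℕ.n<1+n s) a>1+s))
        | ⟦⟧-no (a ℕ.≟ suc s) (ℕ.>⇒≢ a>1+s) = refl

[1+n]C2≡n+nC2 : ∀ n → suc n C 2 ≡ n ℕ.+ n C 2
[1+n]C2≡n+nC2 n = trans (sym (nCk+nC[k+1]≡[n+1]C[k+1] n 1)) (cong (ℕ._+ n C 2) (nC1≡n n))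

m∸n≡1+m∸[1+n] : ∀ {m n} → n < m → m ∸ n ≡ suc (m ∸ suc n)
m∸n≡1+m∸[1+n] n<m = ℕ.+-∸-assoc 1 n<m

m+[1+n]≡1+[n+m] : ∀ m n → m ℕ.+ suc n ≡ suc (n ℕ.+ m)
m+[1+n]≡1+[n+m] m n = trans (ℕ.+-suc m n) (cong suc (ℕ.+-comm m n))

sumFin≡sum : ∀ {n} (f : Fin n → ℤ) → sumFin f ≡ sum f
sumFin≡sum {zero}  f = refl
sumFin≡sum {suc n} f = cong (_+_ (f Fin.zero)) (sumFin≡sum (f ∘ Fin.suc))

sumFin-cong : ∀ {n} {f g : Fin n → ℤ} → (∀ i → f i ≡ g i) → sumFin f ≡ sumFin g
sumFin-cong {zero}  f≗g = refl
sumFin-cong {suc n} f≗g = cong₂ _+_ (f≗g Fin.zero) (sumFin-cong (f≗g ∘ Fin.suc))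

sumFin-comm : ∀ {m n} (f : Fin m → Fin n → ℤ) →
              sumFin (λ i → sumFin (f i)) ≡ sumFin (λ j → sumFin (λ i → f i j))
sumFin-comm f = begin
  sumFin (λ i → sumFin (f i))            ≡⟨ sumFin≡sum (λ i → sumFin (f i)) ⟩
  sum (λ i → sumFin (f i))               ≡⟨ sum-cong-≗ (λ i → sumFin≡sum (f i)) ⟩
  sum (λ i → sum (f i))                  ≡⟨ ∑-comm f ⟩
  sum (λ j → sum (λ i → f i j))          ≡⟨ sum-cong-≗ (λ j → sumFin≡sum (λ i → f i j)) ⟨
  sum (λ j → sumFin (λ i → f i j))       ≡⟨ sumFin≡sum (λ j → sumFin (λ i → f i j)) ⟨
  sumFin (λ j → sumFin (λ i → f i j))    ∎
  where open ≡-Reasoning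

*-distribˡ-sumFin : ∀ {n} x (f : Fin n → ℤ) → x * sumFin f ≡ sumFin (λ i → x * f i)
*-distribˡ-sumFin x f = begin
  x * sumFin f               ≡⟨ cong (x *_) (sumFin≡sum f) ⟩
  x * sum f                  ≡⟨ *-distribˡ-sum x f ⟩
  sum (λ i → x * f i)        ≡⟨ sumFin≡sum (λ i → x * f i) ⟨
  sumFin (λ i → x * f i)     ∎
  where open ≡-Reasoning

*-distribʳ-sumFin : ∀ {n} x (f : Fin n → ℤ) → sumFin f * x ≡ sumFin (λ i → f i * x)
*-distribʳ-sumFin x f = begin
  sumFin f * x               ≡⟨ cong (_* x) (sumFin≡sum f) ⟩
  sum f * x                  ≡⟨ *-distribʳ-sum x f ⟩
  sum (λ i → f i * x)        ≡⟨ sumFin≡sum (λ i → f i * x) ⟨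
  sumFin (λ i → f i * x)     ∎
  where open ≡-Reasoning

sumFin-zero : ∀ n → sumFin {n} (λ _ → + 0) ≡ + 0
sumFin-zero zero    = refl
sumFin-zero (suc n) = trans (ℤ.+-identityˡ _) (sumFin-zero n)

sumFin-sift : ∀ {n} (i : Fin n) x (g : Fin n → ℤ) →
              sumFin (λ k → (if does (i Fin.≟ k) then x else + 0) * g k) ≡ x * g i
sumFin-sift {suc n} Fin.zero x g =
  trans (cong (_+_ (x * g Fin.zero)) (sumFin-zero n)) (ℤ.+-identityʳ (x * g Fin.zero))
sumFin-sift {suc n} (Fin.suc i) x g =
  trans (ℤ.+-identityˡ _) (sumFin-sift i x (g ∘ Fin.suc))

≋-setoid : ℕ → ℕ → Setoid _ _
≋-setoid m n = record
  { Carrier       = Matrix m n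
  ; _≈_           = _≋_
  ; isEquivalence = record
    { refl  = λ _ _ → refl
    ; sym   = λ A≋B i j → sym (A≋B i j)
    ; trans = λ A≋B B≋C i j → trans (A≋B i j) (B≋C i j)
    }
  }

module ≋-Reasoning {m n : ℕ} = Relation.Binary.Reasoning.Setoid (≋-setoid m n)

⊗-cong : ∀ {m k n} {A A' : Matrix m k} {B B' : Matrix k n} →
         A ≋ A' → B ≋ B' → (A ⊗ B) ≋ (A' ⊗ B')
⊗-cong A≋A' B≋B' i j = sumFin-cong (λ l → cong₂ _*_ (A≋A' i l) (B≋B' l j))

⊗-congˡ : ∀ {m k n} {A : Matrix m k} {B B' : Matrix k n} → B ≋ B' → (A ⊗ B) ≋ (A ⊗ B')
⊗-congˡ {A = A} = ⊗-cong {A = A} (λ _ _ → refl)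

⊗-congʳ : ∀ {m k n} {A A' : Matrix m k} {B : Matrix k n} → A ≋ A' → (A ⊗ B) ≋ (A' ⊗ B)
⊗-congʳ {B = B} A≋A' = ⊗-cong {B = B} A≋A' (λ _ _ → refl)

⊗-assoc : ∀ {a b c d} (A : Matrix a b) (B : Matrix b c) (C : Matrix c d) →
          ((A ⊗ B) ⊗ C) ≋ (A ⊗ (B ⊗ C))
⊗-assoc A B C i j = begin
  sumFin (λ l → sumFin (λ k → A i k * B k l) * C l j)
    ≡⟨ sumFin-cong (λ l → *-distribʳ-sumFin (C l j) (λ k → A i k * B k l)) ⟩
  sumFin (λ l → sumFin (λ k → A i k * B k l * C l j))
    ≡⟨ sumFin-comm (λ l k → A i k * B k l * C l j) ⟩
  sumFin (λ k → sumFin (λ l → A i k * B k l * C l j))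
    ≡⟨ sumFin-cong (λ k → sumFin-cong (λ l → ℤ.*-assoc (A i k) (B k l) (C l j))) ⟩
  sumFin (λ k → sumFin (λ l → A i k * (B k l * C l j)))
    ≡⟨ sumFin-cong (λ k → *-distribˡ-sumFin (A i k) (λ l → B k l * C l j)) ⟨
  sumFin (λ k → A i k * sumFin (λ l → B k l * C l j))
    ∎
  where open ≡-Reasoning

idMat-sym : ∀ {m} (i j : Fin m) → idMat i j ≡ idMat j i
idMat-sym i j with i Fin.≟ j | j Fin.≟ i
... | yes _   | yes _   = refl
... | no _    | no _    = refl
... | yes i≡j | no j≢i  = contradiction (sym i≡j) j≢i
... | no i≢j  | yes j≡i = contradiction (sym j≡i) i≢j

⊗-identityˡ : ∀ {m n} (A : Matrix m n) → (idMat ⊗ A) ≋ A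
⊗-identityˡ A i j = trans (sumFin-sift i (+ 1) (λ k → A k j)) (ℤ.*-identityˡ (A i j))

⊗-identityʳ : ∀ {m n} (A : Matrix m n) → (A ⊗ idMat) ≋ A
⊗-identityʳ A i j = begin
  sumFin (λ k → A i k * idMat k j)   ≡⟨ sumFin-cong (λ k → trans (ℤ.*-comm (A i k) _) (cong (_* A i k) (idMat-sym k j))) ⟩
  sumFin (λ k → idMat j k * A i k)   ≡⟨ ⊗-identityˡ (λ k _ → A i k) j j ⟩
  A i j                              ∎
  where open ≡-Reasoning

diagMat-⊗ : ∀ {m n} (d : Fin m → ℕ) (B : Matrix m n) i j → (diagMat d ⊗ B) i j ≡ + d i * B i j
diagMat-⊗ d B i j = sumFin-sift i (+ d i) (λ k → B k j)

idMat-unimodular : ∀ {m} → IsUnimodular (idMat {m})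
idMat-unimodular = idMat , ⊗-identityˡ idMat , ⊗-identityˡ idMat

⊗-cancel-middle : ∀ {m} (A A' B B' : Matrix m m) → (B ⊗ B') ≋ idMat → ((A ⊗ B) ⊗ (B' ⊗ A')) ≋ (A ⊗ A')
⊗-cancel-middle A A' B B' BB'≋I = begin
  (A ⊗ B) ⊗ (B' ⊗ A')     ≈⟨ ⊗-assoc A B (B' ⊗ A') ⟩
  A ⊗ (B ⊗ (B' ⊗ A'))     ≈⟨ ⊗-congˡ {A = A} (⊗-assoc B B' A') ⟨
  A ⊗ ((B ⊗ B') ⊗ A')     ≈⟨ ⊗-congˡ {A = A} (⊗-congʳ {B = A'} BB'≋I) ⟩
  A ⊗ (idMat ⊗ A')        ≈⟨ ⊗-congˡ {A = A} (⊗-identityˡ A') ⟩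
  A ⊗ A'                  ∎
  where open ≋-Reasoning

⊗-unimodular : ∀ {m} {A B : Matrix m m} → IsUnimodular A → IsUnimodular B → IsUnimodular (A ⊗ B)
⊗-unimodular {A = A} {B} (A' , AA'≋I , A'A≋I) (B' , BB'≋I , B'B≋I) =
  B' ⊗ A' ,
  (λ i j → trans (⊗-cancel-middle A A' B B' BB'≋I i j) (AA'≋I i j)) ,
  (λ i j → trans (⊗-cancel-middle B' B A' A A'A≋I i j) (B'B≋I i j))

-- The last component of IsSmithNormalForm M d is exactly M ∼ diagMat d.
_∼_ : ∀ {m} → Matrix m m → Matrix m m → Set
A ∼ B = ∃₂ λ P Q → IsUnimodular P × IsUnimodular Q × (A ≋ ((P ⊗ B) ⊗ Q))

∼-trans : ∀ {m} {A B C : Matrix m m} → A ∼ B → B ∼ C → A ∼ C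
∼-trans {A = A} {B} {C} (P , Q , P-unimodular , Q-unimodular , A≋PBQ) (P' , Q' , P'-unimodular , Q'-unimodular , B≋P'CQ') =
  P ⊗ P' , Q' ⊗ Q , ⊗-unimodular P-unimodular P'-unimodular , ⊗-unimodular Q'-unimodular Q-unimodular , A≋PP'CQ'Q
  where
  open ≋-Reasoning
  A≋PP'CQ'Q : A ≋ (((P ⊗ P') ⊗ C) ⊗ (Q' ⊗ Q))
  A≋PP'CQ'Q = begin
    A                                  ≈⟨ A≋PBQ ⟩
    (P ⊗ B) ⊗ Q                        ≈⟨ ⊗-congʳ {B = Q} (⊗-congˡ {A = P} B≋P'CQ') ⟩
    (P ⊗ ((P' ⊗ C) ⊗ Q')) ⊗ Q          ≈⟨ ⊗-congʳ {B = Q} (⊗-assoc P (P' ⊗ C) Q') ⟨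
    ((P ⊗ (P' ⊗ C)) ⊗ Q') ⊗ Q          ≈⟨ ⊗-assoc (P ⊗ (P' ⊗ C)) Q' Q ⟩
    (P ⊗ (P' ⊗ C)) ⊗ (Q' ⊗ Q)          ≈⟨ ⊗-congʳ {B = Q' ⊗ Q} (⊗-assoc P P' C) ⟨
    ((P ⊗ P') ⊗ C) ⊗ (Q' ⊗ Q)          ∎

∼-viaˡ : ∀ {m} {A B P : Matrix m m} → IsUnimodular P → A ≋ (P ⊗ B) → A ∼ B
∼-viaˡ {B = B} {P} P-unimodular A≋PB =
  P , idMat , P-unimodular , idMat-unimodular ,
  (λ i j → trans (A≋PB i j) (sym (⊗-identityʳ (P ⊗ B) i j)))

∼-viaʳ : ∀ {m} {A B Q : Matrix m m} → IsUnimodular Q → A ≋ (B ⊗ Q) → A ∼ B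
∼-viaʳ {B = B} {Q} Q-unimodular A≋BQ =
  idMat , Q , idMat-unimodular , Q-unimodular ,
  (λ i j → trans (A≋BQ i j) (⊗-congʳ {B = Q} (λ i' j' → sym (⊗-identityˡ B i' j')) i j))

-- Matrices indexed by ℕ

∑ : ℕ → (ℕ → ℤ) → ℤ
∑ m h = sumFin {m} (h ∘ toℕ)

∑-cong : ∀ m {h h' : ℕ → ℤ} → (∀ {k} → k < m → h k ≡ h' k) → ∑ m h ≡ ∑ m h'
∑-cong m h≗h' = sumFin-cong (λ k → h≗h' (toℕ<n k))

∑-sift : ∀ m a (g : ℕ → ℤ) → ∑ m (λ k → δ a k * g k) ≡ ⟦ a <ᵇ m ⟧ * g a
∑-sift zero    a       g = refl
∑-sift (suc m) zero    g = trans (cong (_+_ (+ 1 * g 0)) (sumFin-zero m)) (ℤ.+-identityʳ (+ 1 * g 0))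
∑-sift (suc m) (suc a) g = trans (ℤ.+-identityˡ _) (∑-sift m a (g ∘ suc))

∑-sift-< : ∀ {m a} (g : ℕ → ℤ) → a < m → ∑ m (λ k → δ a k * g k) ≡ g a
∑-sift-< {m} {a} g a<m = begin
  ∑ m (λ k → δ a k * g k)   ≡⟨ ∑-sift m a g ⟩
  ⟦ a <ᵇ m ⟧ * g a          ≡⟨ cong (_* g a) (⟦⟧-yes (a ℕ.<? m) a<m) ⟩
  + 1 * g a                 ≡⟨ ℤ.*-identityˡ (g a) ⟩
  g a                       ∎
  where open ≡-Reasoning

∑-sub : ∀ m (u v g : ℕ → ℤ) →
        ∑ m (λ k → (u k - v k) * g k) ≡ ∑ m (λ k → u k * g k) - ∑ m (λ k → v k * g k)
∑-sub zero    u v g = refl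
∑-sub (suc m) u v g =
  trans (cong (_+_ ((u 0 - v 0) * g 0)) (∑-sub m (u ∘ suc) (v ∘ suc) (g ∘ suc)))
        (regroup (u 0) (v 0) (g 0) (∑ m (λ k → u (suc k) * g (suc k))) (∑ m (λ k → v (suc k) * g (suc k))))
  where
  regroup : ∀ a b x s t → (a - b) * x + (s - t) ≡ (a * x + s) - (b * x + t)
  regroup = solve-∀

∑-add-scaled : ∀ m c (u v g : ℕ → ℤ) →
               ∑ m (λ k → (u k + c * v k) * g k) ≡ ∑ m (λ k → u k * g k) + c * ∑ m (λ k → v k * g k)
∑-add-scaled zero    c u v g = sym (trans (ℤ.+-identityˡ (c * + 0)) (ℤ.*-zeroʳ c))
∑-add-scaled (suc m) c u v g =
  trans (cong (_+_ ((u 0 + c * v 0) * g 0)) (∑-add-scaled m c (u ∘ suc) (v ∘ suc) (g ∘ suc)))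
        (regroup (u 0) (v 0) (g 0) c (∑ m (λ k → u (suc k) * g (suc k))) (∑ m (λ k → v (suc k) * g (suc k))))
  where
  regroup : ∀ a b x c s t → (a + c * b) * x + (s + c * t) ≡ (a * x + s) + c * (b * x + t)
  regroup = solve-∀

module SquareMatrix (m : ℕ) where

  infixl 7 _·_
  infix 4 _≈_

  _·_ : (ℕ → ℕ → ℤ) → (ℕ → ℕ → ℤ) → ℕ → ℕ → ℤ
  (f · g) i j = ∑ m (λ k → f i k * g k j)

  -- An ℕ-indexed matrix is arbitrary outside the m × m block seen by toMatrix, so _≈_ compares only that block.
  _≈_ : (ℕ → ℕ → ℤ) → (ℕ → ℕ → ℤ) → Set
  f ≈ g = ∀ {i j} → i < m → j < m → f i j ≡ g i j

  ≈-trans : ∀ {f g h} → f ≈ g → g ≈ h → f ≈ h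
  ≈-trans f≈g g≈h i<m j<m = trans (f≈g i<m j<m) (g≈h i<m j<m)

  _ᵀ : (ℕ → ℕ → ℤ) → ℕ → ℕ → ℤ
  (f ᵀ) i j = f j i

  toMatrix : (ℕ → ℕ → ℤ) → Matrix m m
  toMatrix f i j = f (toℕ i) (toℕ j)

  toMatrix-cong : ∀ {f g} → f ≈ g → toMatrix f ≋ toMatrix g
  toMatrix-cong f≈g i j = f≈g (toℕ<n i) (toℕ<n j)

  ·-congˡ : ∀ {f g g'} → g ≈ g' → f · g ≈ f · g'
  ·-congˡ {f} {g} {g'} g≈g' {i} {j} _ j<m =
    ∑-cong m {λ k → f i k * g k j} {λ k → f i k * g' k j} (λ {k} k<m → cong (f i k *_) (g≈g' k<m j<m))

  ·-transpose : ∀ f g i j → ((f · g) ᵀ) i j ≡ (g ᵀ · f ᵀ) i j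
  ·-transpose f g i j = ∑-cong m (λ {k} _ → ℤ.*-comm (f j k) (g k i))

  RightInverse : (ℕ → ℕ → ℤ) → (ℕ → ℕ → ℤ) → Set
  RightInverse f g = f · g ≈ δ

  Inverse : (ℕ → ℕ → ℤ) → (ℕ → ℕ → ℤ) → Set
  Inverse f g = RightInverse f g × RightInverse g f

  RightInverse-transpose : ∀ {f g} → RightInverse f g → RightInverse (g ᵀ) (f ᵀ)
  RightInverse-transpose {f} {g} fg≈δ {i} {j} i<m j<m = begin
    (g ᵀ · f ᵀ) i j   ≡⟨ ·-transpose f g i j ⟨
    (f · g) j i       ≡⟨ fg≈δ j<m i<m ⟩
    δ j i             ≡⟨ δ-sym j i ⟩
    δ i j             ∎
    where open ≡-Reasoning

  idMat≋δ : idMat ≋ toMatrix δ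
  idMat≋δ i j with i Fin.≟ j
  ... | yes refl = sym (⟦⟧-yes (toℕ i ℕ.≟ toℕ i) refl)
  ... | no i≢j   = sym (⟦⟧-no (toℕ i ℕ.≟ toℕ j) (i≢j ∘ toℕ-injective))

  toMatrix-unimodular : ∀ f g → Inverse f g → IsUnimodular (toMatrix f)
  toMatrix-unimodular f g (fg≈δ , gf≈δ) =
    toMatrix g ,
    (λ i j → trans (toMatrix-cong fg≈δ i j) (sym (idMat≋δ i j))) ,
    (λ i j → trans (toMatrix-cong gf≈δ i j) (sym (idMat≋δ i j)))

  diff : ℕ → ℕ → ℤ
  diff i x = δ i x - δ (suc i) x

  upperOnes : ℕ → ℕ → ℤ
  upperOnes i x = ⟦ i ≤ᵇ x ⟧

  backDiff : ℕ → ℕ → ℤ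
  backDiff zero    x = δ zero x
  backDiff (suc i) x = δ (suc i) x - δ i x

  diff-· : ∀ g {i} j → i < m → (diff · g) i j ≡ g i j - ⟦ suc i <ᵇ m ⟧ * g (suc i) j
  diff-· g {i} j i<m = begin
    ∑ m (λ k → (δ i k - δ (suc i) k) * g k j)
      ≡⟨ ∑-sub m (δ i) (δ (suc i)) (λ k → g k j) ⟩
    ∑ m (λ k → δ i k * g k j) - ∑ m (λ k → δ (suc i) k * g k j)
      ≡⟨ cong₂ _-_ (∑-sift-< (λ k → g k j) i<m) (∑-sift m (suc i) (λ k → g k j)) ⟩
    g i j - ⟦ suc i <ᵇ m ⟧ * g (suc i) j
      ∎
    where open ≡-Reasoning

  backDiff-·-zero : ∀ g j → 0 < m → (backDiff · g) 0 j ≡ g 0 j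
  backDiff-·-zero g j 0<m = ∑-sift-< (λ k → g k j) 0<m

  backDiff-·-suc : ∀ g {i} j → suc i < m → (backDiff · g) (suc i) j ≡ g (suc i) j - g i j
  backDiff-·-suc g {i} j i+1<m = begin
    ∑ m (λ k → (δ (suc i) k - δ i k) * g k j)
      ≡⟨ ∑-sub m (δ (suc i)) (δ i) (λ k → g k j) ⟩
    ∑ m (λ k → δ (suc i) k * g k j) - ∑ m (λ k → δ i k * g k j)
      ≡⟨ cong₂ _-_ (∑-sift-< (λ k → g k j) i+1<m) (∑-sift-< (λ k → g k j) (ℕ.<-trans (ℕ.n<1+n i) i+1<m)) ⟩
    g (suc i) j - g i j
      ∎
    where open ≡-Reasoning

  backDiff≡diffᵀ : ∀ i x → backDiff i x ≡ (diff ᵀ) i x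
  backDiff≡diffᵀ zero    zero    = refl
  backDiff≡diffᵀ zero    (suc x) = refl
  backDiff≡diffᵀ (suc i) zero    = cong₂ _-_ (δ-sym (suc i) 0) (δ-sym i 0)
  backDiff≡diffᵀ (suc i) (suc x) = cong₂ _-_ (δ-sym i x) (δ-sym i (suc x))

  diff·upperOnes : RightInverse diff upperOnes
  diff·upperOnes {i} {j} i<m j<m with diff-· upperOnes j i<m | ℕ.<-cmp i j
  ... | eq | tri< i<j _ _
    rewrite ⟦⟧-yes (i ℕ.≤? j) (ℕ.<⇒≤ i<j) | ⟦⟧-yes (suc i ℕ.<? m) (ℕ.≤-<-trans i<j j<m)
          | ⟦⟧-yes (suc i ℕ.≤? j) i<j | ⟦⟧-no (i ℕ.≟ j) (ℕ.<⇒≢ i<j) = eq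
  ... | eq | tri≈ _ refl _
    rewrite ⟦⟧-yes (i ℕ.≤? i) ℕ.≤-refl | ⟦⟧-no (suc i ℕ.≤? i) ℕ.1+n≰n
          | ℤ.*-zeroʳ ⟦ suc i <ᵇ m ⟧ | ⟦⟧-yes (i ℕ.≟ i) refl = eq
  ... | eq | tri> _ _ i>j
    rewrite ⟦⟧-no (i ℕ.≤? j) (ℕ.<⇒≱ i>j) | ⟦⟧-no (suc i ℕ.≤? j) (ℕ.<⇒≱ (ℕ.<-trans i>j (ℕ.n<1+n i)))
          | ℤ.*-zeroʳ ⟦ suc i <ᵇ m ⟧ | ⟦⟧-no (i ℕ.≟ j) (ℕ.>⇒≢ i>j) = eq

  backDiff·lowerOnes : RightInverse backDiff (upperOnes ᵀ)
  backDiff·lowerOnes {zero}  {j}     0<m   _ = trans (backDiff-·-zero (upperOnes ᵀ) j 0<m) (lowerOnes-zero j)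
    where
    lowerOnes-zero : ∀ j → ⟦ j ≤ᵇ 0 ⟧ ≡ δ 0 j
    lowerOnes-zero zero    = refl
    lowerOnes-zero (suc j) = refl
  backDiff·lowerOnes {suc i} {j} i+1<m _ = begin
    (backDiff · upperOnes ᵀ) (suc i) j   ≡⟨ backDiff-·-suc (upperOnes ᵀ) j i+1<m ⟩
    ⟦ j ≤ᵇ suc i ⟧ - ⟦ j ≤ᵇ i ⟧          ≡⟨ cong (_- ⟦ j ≤ᵇ i ⟧) (⟦≤ᵇ-suc⟧ j i) ⟩
    ⟦ j ≤ᵇ i ⟧ + δ j (suc i) - ⟦ j ≤ᵇ i ⟧ ≡⟨ cancel ⟦ j ≤ᵇ i ⟧ (δ j (suc i)) ⟩
    δ j (suc i)                          ≡⟨ δ-sym j (suc i) ⟩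
    δ (suc i) j                          ∎
    where
    open ≡-Reasoning
    cancel : ∀ a b → a + b - a ≡ b
    cancel = solve-∀

  diff-inverse : Inverse diff upperOnes
  diff-inverse = diff·upperOnes ,
    ≈-trans {g = upperOnes · backDiff ᵀ}
      (·-congˡ {upperOnes} (λ {x} {i} _ _ → sym (backDiff≡diffᵀ i x)))
      (RightInverse-transpose {backDiff} {upperOnes ᵀ} backDiff·lowerOnes)

  backDiff-inverse : Inverse backDiff (upperOnes ᵀ)
  backDiff-inverse = backDiff·lowerOnes ,
    ≈-trans {g = upperOnes ᵀ · diff ᵀ}
      (·-congˡ {upperOnes ᵀ} (λ {x} {i} _ _ → backDiff≡diffᵀ x i))
      (RightInverse-transpose {diff} {upperOnes} diff·upperOnes)

  perm : (ℕ → ℕ) → ℕ → ℕ → ℤ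
  perm π i x = δ (π i) x

  perm-· : ∀ π g {i} j → π i < m → (perm π · g) i j ≡ g (π i) j
  perm-· π g j πi<m = ∑-sift-< (λ k → g k j) πi<m

  perm·perm : ∀ π π' → (∀ {i} → i < m → π i < m × π' (π i) ≡ i) → RightInverse (perm π) (perm π')
  perm·perm π π' π'∘π≡id {i} {j} i<m _ =
    trans (perm-· π (perm π') j (proj₁ (π'∘π≡id i<m))) (cong (λ t → δ t j) (proj₂ (π'∘π≡id i<m)))

  perm-inverse : ∀ π π' → (∀ {i} → i < m → π i < m × π' (π i) ≡ i) →
                 (∀ {i} → i < m → π' i < m × π (π' i) ≡ i) → Inverse (perm π) (perm π')
  perm-inverse π π' π'∘π≡id π∘π'≡id = perm·perm π π' π'∘π≡id , perm·perm π' π π∘π'≡id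

  shear : ℕ → (ℕ → ℤ) → ℕ → ℕ → ℤ
  shear r c i x = δ i x + c i * δ r x

  shear-· : ∀ r c g {i} j → i < m → r < m → (shear r c · g) i j ≡ g i j + c i * g r j
  shear-· r c g {i} j i<m r<m =
    trans (∑-add-scaled m (c i) (δ i) (δ r) (λ k → g k j))
          (cong₂ _+_ (∑-sift-< (λ k → g k j) i<m) (cong (c i *_) (∑-sift-< (λ k → g k j) r<m)))

  shear·shear : ∀ r c c' → r < m → c' r ≡ + 0 → (∀ i → c i + c' i ≡ + 0) →
                RightInverse (shear r c) (shear r c')
  shear·shear r c c' r<m c'r≡0 c+c'≡0 {i} {j} i<m _ = begin
    (shear r c · shear r c') i j                                 ≡⟨ shear-· r c (shear r c') j i<m r<m ⟩
    δ i j + c' i * δ r j + c i * (δ r j + c' r * δ r j)          ≡⟨ cong (λ t → δ i j + c' i * δ r j + c i * (δ r j + t * δ r j)) c'r≡0 ⟩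
    δ i j + c' i * δ r j + c i * (δ r j + + 0 * δ r j)           ≡⟨ regroup (δ i j) (δ r j) (c i) (c' i) ⟩
    δ i j + (c i + c' i) * δ r j                                 ≡⟨ cong (λ t → δ i j + t * δ r j) (c+c'≡0 i) ⟩
    δ i j + + 0 * δ r j                                          ≡⟨ ℤ.+-identityʳ (δ i j) ⟩
    δ i j                                                        ∎
    where
    open ≡-Reasoning
    regroup : ∀ a b x y → a + y * b + x * (b + + 0 * b) ≡ a + (x + y) * b
    regroup = solve-∀

  shear-inverse : ∀ r c → r < m → c r ≡ + 0 → Inverse (shear r c) (shear r (-_ ∘ c))
  shear-inverse r c r<m cr≡0 =
    shear·shear r c (-_ ∘ c) r<m (cong -_ cr≡0) (λ i → ℤ.+-inverseʳ (c i)) ,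
    shear·shear r (-_ ∘ c) c r<m cr≡0 (λ i → ℤ.+-inverseˡ (c i))

-- The matrices M (2 + L)

module Construction (L : ℕ) where

  m n : ℕ
  m = suc L
  n = suc m

  open SquareMatrix m

  L<m : L < m
  L<m = ℕ.n<1+n L

  Mℕ : ℕ → ℕ → ℤ
  Mℕ i j = + 1 - δ (i ℕ.+ j) L + δ (suc (i ℕ.+ j)) L

  M-entry : ∀ s → (if s ℕ.+ 2 ≡ᵇ n then + 0 else if s ℕ.+ 2 ≡ᵇ m then + 2 else + 1) ≡ + 1 - δ s L + δ (suc s) L
  M-entry s rewrite ℕ.+-comm s 2 with s ℕ.≟ L
  ... | yes refl rewrite dec-true (s ℕ.≟ s) refl | dec-false (suc s ℕ.≟ s) (ℕ.>⇒≢ (ℕ.n<1+n s)) = refl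
  ... | no s≢L with suc s ℕ.≟ L
  ...   | yes refl rewrite dec-false (s ℕ.≟ suc s) (ℕ.<⇒≢ (ℕ.n<1+n s)) | dec-true (suc s ℕ.≟ suc s) refl = refl
  ...   | no 1+s≢L rewrite dec-false (s ℕ.≟ L) s≢L | dec-false (suc s ℕ.≟ L) 1+s≢L = refl

  X : ℕ → ℕ → ℤ
  X i j = + (m ∸ i) - δ (i ℕ.+ j) L

  diff·X : diff · X ≈ Mℕ
  diff·X {i} {j} i<m j<m with ℕ.m≤n⇒m<n∨m≡n (ℕ.≤-pred i<m)
  ... | inj₁ i<L = begin
    (diff · X) i j                                  ≡⟨ diff-· X j i<m ⟩
    X i j - ⟦ suc i <ᵇ m ⟧ * X (suc i) j            ≡⟨ cong₂ (λ a b → + a - δ s L - b * X (suc i) j)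
                                                             (m∸n≡1+m∸[1+n] i<m) (⟦⟧-yes (suc i ℕ.<? m) (s≤s i<L)) ⟩
    + 1 + + r - δ s L - + 1 * (+ r - δ (suc s) L)   ≡⟨ simplify (+ r) (δ s L) (δ (suc s) L) ⟩
    + 1 - δ s L + δ (suc s) L                       ∎
    where
    open ≡-Reasoning
    r = m ∸ suc i
    s = i ℕ.+ j
    simplify : ∀ r a b → + 1 + r - a - + 1 * (r - b) ≡ + 1 - a + b
    simplify = solve-∀
  ... | inj₂ refl = begin
    (diff · X) L j                                  ≡⟨ diff-· X j i<m ⟩
    X L j - ⟦ m <ᵇ m ⟧ * X m j                      ≡⟨ cong (λ b → X L j - b * X m j) (⟦⟧-no (m ℕ.<? m) (ℕ.n≮n m)) ⟩
    X L j - + 0                                     ≡⟨ ℤ.+-identityʳ (X L j) ⟩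
    + (m ∸ L) - δ s L                               ≡⟨ cong (λ t → + t - δ s L) (ℕ.m+n∸n≡m 1 L) ⟩
    + 1 - δ s L                                     ≡⟨ ℤ.+-identityʳ (+ 1 - δ s L) ⟨
    + 1 - δ s L + + 0                               ≡⟨ cong (_+_ (+ 1 - δ s L)) (⟦⟧-no (suc s ℕ.≟ L) (ℕ.>⇒≢ (s≤s (ℕ.m≤m+n L j)))) ⟨
    + 1 - δ s L + δ (suc s) L                       ∎
    where
    open ≡-Reasoning
    s = L ℕ.+ j

  M∼X : M n ∼ toMatrix X
  M∼X = ∼-viaˡ {B = toMatrix X} {P = toMatrix diff}
          (toMatrix-unimodular diff upperOnes diff-inverse)
          (λ i j → trans (M-entry (toℕ i ℕ.+ toℕ j)) (sym (toMatrix-cong {diff · X} diff·X i j)))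

  S : ℕ → ℕ
  S zero    = m
  S (suc i) = S i ℕ.+ (m ∸ suc i)

  S+C2≡nC2 : ∀ {i} → i < m → S i ℕ.+ (m ∸ i) C 2 ≡ n C 2
  S+C2≡nC2 {zero}  _     = sym ([1+n]C2≡n+nC2 m)
  S+C2≡nC2 {suc i} i+1<m = begin
    S i ℕ.+ r ℕ.+ r C 2          ≡⟨ ℕ.+-assoc (S i) r (r C 2) ⟩
    S i ℕ.+ (r ℕ.+ r C 2)        ≡⟨ cong (S i ℕ.+_) ([1+n]C2≡n+nC2 r) ⟨
    S i ℕ.+ suc r C 2            ≡⟨ cong (λ t → S i ℕ.+ t C 2) (m∸n≡1+m∸[1+n] (ℕ.<⇒≤ i+1<m)) ⟨
    S i ℕ.+ (m ∸ i) C 2          ≡⟨ S+C2≡nC2 (ℕ.<⇒≤ i+1<m) ⟩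
    n C 2                        ∎
    where
    open ≡-Reasoning
    r = m ∸ suc i

  S-last : S L ≡ n C 2
  S-last = trans (sym (ℕ.+-identityʳ (S L))) (subst (λ t → S L ℕ.+ t C 2 ≡ n C 2) (ℕ.m+n∸n≡m 1 L) (S+C2≡nC2 L<m))

  Y : ℕ → ℕ → ℤ
  Y i j = + S i - ⟦ L ≤ᵇ i ℕ.+ j ⟧

  ⟦L≤ᵇ⟧≡δ : ∀ {j} → j ≤ L → ⟦ L ≤ᵇ j ⟧ ≡ δ j L
  ⟦L≤ᵇ⟧≡δ {j} j≤L with j ℕ.≟ L
  ... | yes refl rewrite ⟦⟧-yes (j ℕ.≤? j) ℕ.≤-refl | ⟦⟧-yes (j ℕ.≟ j) refl = refl
  ... | no j≢L rewrite ⟦⟧-no (L ℕ.≤? j) (ℕ.<⇒≱ (ℕ.≤∧≢⇒< j≤L j≢L)) | ⟦⟧-no (j ℕ.≟ L) j≢L = refl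

  backDiff·Y : backDiff · Y ≈ X
  backDiff·Y {zero} {j} 0<m j<m = begin
    (backDiff · Y) 0 j             ≡⟨ backDiff-·-zero Y j 0<m ⟩
    + m - ⟦ L ≤ᵇ j ⟧               ≡⟨ cong (_-_ (+ m)) (⟦L≤ᵇ⟧≡δ (ℕ.≤-pred j<m)) ⟩
    + m - δ j L                    ∎
    where open ≡-Reasoning
  backDiff·Y {suc i} {j} i+1<m _ = begin
    (backDiff · Y) (suc i) j                                          ≡⟨ backDiff-·-suc Y j i+1<m ⟩
    + (S i ℕ.+ r) - ⟦ L ≤ᵇ suc s ⟧ - (+ S i - ⟦ L ≤ᵇ s ⟧)             ≡⟨ cong₂ (λ a b → a - b - (+ S i - ⟦ L ≤ᵇ s ⟧))
                                                                                (ℤ.pos-+ (S i) r) (⟦≤ᵇ-suc⟧ L s) ⟩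
    + S i + + r - (⟦ L ≤ᵇ s ⟧ + δ L (suc s)) - (+ S i - ⟦ L ≤ᵇ s ⟧)   ≡⟨ simplify (+ S i) (+ r) ⟦ L ≤ᵇ s ⟧ (δ L (suc s)) ⟩
    + r - δ L (suc s)                                                 ≡⟨ cong (_-_ (+ r)) (δ-sym L (suc s)) ⟩
    + r - δ (suc s) L                                                 ∎
    where
    open ≡-Reasoning
    r = m ∸ suc i
    s = i ℕ.+ j
    simplify : ∀ a r b e → a + r - (b + e) - (a - b) ≡ r - e
    simplify = solve-∀

  X∼Y : toMatrix X ∼ toMatrix Y
  X∼Y = ∼-viaˡ {B = toMatrix Y} {P = toMatrix backDiff}
          (toMatrix-unimodular backDiff (upperOnes ᵀ) backDiff-inverse)
          (λ i j → sym (toMatrix-cong {backDiff · Y} backDiff·Y i j))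

  reverse : ℕ → ℕ → ℤ
  reverse = perm (L ∸_)

  reverse-inverse : Inverse reverse reverse
  reverse-inverse = perm-inverse (L ∸_) (L ∸_) involutive involutive
    where
    involutive : ∀ {i} → i < m → L ∸ i < m × L ∸ (L ∸ i) ≡ i
    involutive {i} i<m = s≤s (ℕ.m∸n≤m L i) , ℕ.m∸[m∸n]≡n (ℕ.≤-pred i<m)

  rot unrot : ℕ → ℕ
  rot i = if i ≡ᵇ L then 0 else suc i
  unrot zero    = L
  unrot (suc i) = i

  rot-last : rot L ≡ 0
  rot-last = cong (if_then 0 else suc L) (dec-true (L ℕ.≟ L) refl)

  rot-< : ∀ {i} → i < L → rot i ≡ suc i
  rot-< {i} i<L = cong (if_then 0 else suc i) (dec-false (i ℕ.≟ L) (ℕ.<⇒≢ i<L))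

  unrot∘rot : ∀ {i} → i < m → rot i < m × unrot (rot i) ≡ i
  unrot∘rot {i} i<m with ℕ.m≤n⇒m<n∨m≡n (ℕ.≤-pred i<m)
  ... | inj₁ i<L rewrite rot-< i<L = s≤s i<L , refl
  ... | inj₂ refl rewrite rot-last = s≤s z≤n , refl

  rotate : ℕ → ℕ → ℤ
  rotate = perm rot

  rotate-inverse : Inverse rotate (perm unrot)
  rotate-inverse = perm-inverse rot unrot unrot∘rot rot∘unrot
    where
    rot∘unrot : ∀ {i} → i < m → unrot i < m × rot (unrot i) ≡ i
    rot∘unrot {zero}  _     = L<m , rot-last
    rot∘unrot {suc i} i+1<m = ℕ.<-trans (ℕ.n<1+n i) i+1<m , rot-< (ℕ.≤-pred i+1<m)

  c : ℕ → ℤ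
  c i = if i ≡ᵇ L then + 0 else + S i - + 1

  c-last : c L ≡ + 0
  c-last = cong (if_then + 0 else + S L - + 1) (dec-true (L ℕ.≟ L) refl)

  c-< : ∀ {i} → i < L → c i ≡ + S i - + 1
  c-< {i} i<L = cong (if_then + 0 else + S i - + 1) (dec-false (i ℕ.≟ L) (ℕ.<⇒≢ i<L))

  Q : ℕ → ℕ → ℤ
  Q = shear L c · (rotate · (reverse · upperOnes ᵀ))

  Q-unimodular : IsUnimodular (toMatrix Q)
  Q-unimodular =
    ⊗-unimodular {A = toMatrix (shear L c)} {B = toMatrix (rotate · (reverse · upperOnes ᵀ))}
      (toMatrix-unimodular (shear L c) (shear L (-_ ∘ c)) (shear-inverse L c L<m c-last))
      (⊗-unimodular {A = toMatrix rotate} {B = toMatrix (reverse · upperOnes ᵀ)}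
        (toMatrix-unimodular rotate (perm unrot) rotate-inverse)
        (⊗-unimodular {A = toMatrix reverse} {B = toMatrix (upperOnes ᵀ)}
          (toMatrix-unimodular reverse reverse reverse-inverse)
          (toMatrix-unimodular (upperOnes ᵀ) backDiff (proj₂ backDiff-inverse , proj₁ backDiff-inverse))))

  rotated-rows : ∀ {i} j → i < m → (rotate · (reverse · upperOnes ᵀ)) i j ≡ ⟦ j ≤ᵇ L ∸ rot i ⟧
  rotated-rows {i} j i<m =
    trans (perm-· rot (reverse · upperOnes ᵀ) {i} j (proj₁ (unrot∘rot i<m)))
          (perm-· (L ∸_) (upperOnes ᵀ) {rot i} j (s≤s (ℕ.m∸n≤m L (rot i))))

  Q-rows : ∀ {i j} → i < m → j < m → Q i j ≡ ⟦ j ≤ᵇ L ∸ rot i ⟧ + c i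
  Q-rows {i} {j} i<m j<m = begin
    Q i j                                           ≡⟨ shear-· L c T j i<m L<m ⟩
    T i j + c i * T L j                             ≡⟨ cong₂ (λ a b → a + c i * b) (rotated-rows j i<m) (rotated-rows j L<m) ⟩
    ⟦ j ≤ᵇ L ∸ rot i ⟧ + c i * ⟦ j ≤ᵇ L ∸ rot L ⟧    ≡⟨ cong (λ t → ⟦ j ≤ᵇ L ∸ rot i ⟧ + c i * ⟦ j ≤ᵇ L ∸ t ⟧) rot-last ⟩
    ⟦ j ≤ᵇ L ∸ rot i ⟧ + c i * ⟦ j ≤ᵇ L ⟧            ≡⟨ cong (λ t → ⟦ j ≤ᵇ L ∸ rot i ⟧ + c i * t) (⟦⟧-yes (j ℕ.≤? L) (ℕ.≤-pred j<m)) ⟩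
    ⟦ j ≤ᵇ L ∸ rot i ⟧ + c i * + 1                   ≡⟨ cong (_+_ ⟦ j ≤ᵇ L ∸ rot i ⟧) (ℤ.*-identityʳ (c i)) ⟩
    ⟦ j ≤ᵇ L ∸ rot i ⟧ + c i                         ∎
    where
    open ≡-Reasoning
    T = rotate · (reverse · upperOnes ᵀ)

  staircase-complement : ∀ {i} j → i < L → ⟦ j ≤ᵇ L ∸ suc i ⟧ ≡ + 1 - ⟦ L ≤ᵇ i ℕ.+ j ⟧
  staircase-complement {i} j i<L with L ℕ.≤? i ℕ.+ j
  ... | yes L≤i+j
    rewrite ⟦⟧-yes (L ℕ.≤? i ℕ.+ j) L≤i+j
          | ⟦⟧-no (j ℕ.≤? L ∸ suc i)
                  (λ j≤L∸[1+i] → ℕ.<⇒≱ (subst (_≤ L) (m+[1+n]≡1+[n+m] j i) (ℕ.m≤o∸n⇒m+n≤o j i<L j≤L∸[1+i])) L≤i+j) = refl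
  ... | no L≰i+j
    rewrite ⟦⟧-no (L ℕ.≤? i ℕ.+ j) L≰i+j
          | ⟦⟧-yes (j ℕ.≤? L ∸ suc i)
                   (ℕ.m+n≤o⇒m≤o∸n j (subst (_≤ L) (sym (m+[1+n]≡1+[n+m] j i)) (ℕ.≰⇒> L≰i+j))) = refl

  d : ℕ → ℕ
  d i = if i ≡ᵇ L then n C 2 ∸ 1 else 1

  d-last : d L ≡ n C 2 ∸ 1
  d-last = cong (if_then n C 2 ∸ 1 else 1) (dec-true (L ℕ.≟ L) refl)

  d-≢ : ∀ {i} → i ≢ L → d i ≡ 1
  d-≢ {i} i≢L = cong (if_then n C 2 ∸ 1 else 1) (dec-false (i ℕ.≟ L) i≢L)

  nC2∸1≡S-1 : + (n C 2 ∸ 1) ≡ + S L - + 1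
  nC2∸1≡S-1 rewrite S-last | [1+n]C2≡n+nC2 m = refl

  diagonal·Q : ∀ {i j} → i < m → j < m → + d i * Q i j ≡ Y i j
  diagonal·Q {i} {j} i<m j<m with ℕ.m≤n⇒m<n∨m≡n (ℕ.≤-pred i<m)
  ... | inj₁ i<L = begin
    + d i * Q i j                                   ≡⟨ cong₂ (λ a b → + a * b) (d-≢ (ℕ.<⇒≢ i<L)) (Q-rows i<m j<m) ⟩
    + 1 * (⟦ j ≤ᵇ L ∸ rot i ⟧ + c i)                ≡⟨ cong₂ (λ a b → + 1 * (⟦ j ≤ᵇ L ∸ a ⟧ + b)) (rot-< i<L) (c-< i<L) ⟩
    + 1 * (⟦ j ≤ᵇ L ∸ suc i ⟧ + (+ S i - + 1))      ≡⟨ cong (λ t → + 1 * (t + (+ S i - + 1))) (staircase-complement j i<L) ⟩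
    + 1 * (+ 1 - ⟦ L ≤ᵇ i ℕ.+ j ⟧ + (+ S i - + 1)) ≡⟨ simplify (+ S i) ⟦ L ≤ᵇ i ℕ.+ j ⟧ ⟩
    + S i - ⟦ L ≤ᵇ i ℕ.+ j ⟧                        ∎
    where
    open ≡-Reasoning
    simplify : ∀ s b → + 1 * (+ 1 - b + (s - + 1)) ≡ s - b
    simplify = solve-∀
  ... | inj₂ refl = begin
    + d L * Q L j                                   ≡⟨ cong₂ (λ a b → + a * b) d-last (Q-rows i<m j<m) ⟩
    + (n C 2 ∸ 1) * (⟦ j ≤ᵇ L ∸ rot L ⟧ + c L)      ≡⟨ cong₂ (λ a b → + (n C 2 ∸ 1) * (⟦ j ≤ᵇ L ∸ a ⟧ + b)) rot-last c-last ⟩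
    + (n C 2 ∸ 1) * (⟦ j ≤ᵇ L ⟧ + + 0)              ≡⟨ cong (λ t → + (n C 2 ∸ 1) * (t + + 0)) (⟦⟧-yes (j ℕ.≤? L) (ℕ.≤-pred j<m)) ⟩
    + (n C 2 ∸ 1) * + 1                             ≡⟨ ℤ.*-identityʳ (+ (n C 2 ∸ 1)) ⟩
    + (n C 2 ∸ 1)                                   ≡⟨ nC2∸1≡S-1 ⟩
    + S L - + 1                                     ≡⟨ cong (λ t → + S L - t) (⟦⟧-yes (L ℕ.≤? L ℕ.+ j) (ℕ.m≤m+n L j)) ⟨
    + S L - ⟦ L ≤ᵇ L ℕ.+ j ⟧                        ∎
    where open ≡-Reasoning

  Y∼diagonal : toMatrix Y ∼ diagMat (targetDiag n)
  Y∼diagonal = ∼-viaʳ {A = toMatrix Y} {B = diagMat (targetDiag n)} {Q = toMatrix Q} Q-unimodular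
    (λ i j → trans (sym (diagonal·Q (toℕ<n i) (toℕ<n j))) (sym (diagMat-⊗ (targetDiag n) (toMatrix Q) i j)))

  M∼diagonal : M n ∼ diagMat (targetDiag n)
  M∼diagonal = ∼-trans {B = toMatrix X} {C = diagMat (targetDiag n)} M∼X
                 (∼-trans {B = toMatrix Y} {C = diagMat (targetDiag n)} X∼Y Y∼diagonal)

  d-positive : 1 ≤ L → ∀ i → 0 < d i
  d-positive 1≤L i with i ℕ.≟ L
  ... | yes refl rewrite d-last | [1+n]C2≡n+nC2 m = ℕ.≤-trans 1≤L (ℕ.m≤m+n L (m C 2))
  ... | no i≢L rewrite d-≢ i≢L = s≤s z≤n

  d-divides : ∀ {i j} → i ≤ j → j ≤ L → d i ∣ d j
  d-divides {i} {j} i≤j j≤L with i ℕ.≟ L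
  ... | yes refl rewrite ℕ.≤-antisym j≤L i≤j = ∣-refl
  ... | no i≢L rewrite d-≢ i≢L = 1∣ d j

mainTheorem2 : (n : ℕ) → 3 ≤ n → IsSmithNormalForm (M n) (targetDiag n)
mainTheorem2 (suc (suc L)) (s≤s (s≤s 1≤L)) =
  (λ i → d-positive 1≤L (toℕ i)) ,
  (λ i j i≤j → d-divides i≤j (ℕ.≤-pred (toℕ<n j))) ,
  M∼diagonal
  where open Construction L
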